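{- Let $A$ be a coherent quantale and let $(L,\lambda)$ and $(L',\lambda')$ be two reticulations of $A$. Then there exists an isomorphism of bounded distributive lattices $f:L\to L'$ such that $f\circ\lambda=\lambda'$.
   Context: A quantale is a complete lattice $(A,\vee,\wedge,0,1)$ with an associative, commutative multiplication $\cdot$ with unit $1$ distributing over arbitrary joins. $K(A)$ is the set of compact elements; $A$ is coherent if every element is a join of compact elements, $1\in K(A)$ and $K(A)$ is closed under $\cdot$. A reticulation of $A$ is a pair $(L,\lambda)$ where $L$ is a bounded distributive lattice and $\lambda:K(A)\to L$ is a surjective function such that for all $a,b\in K(A)$: (i) $\lambda(a\vee b)\le\lambda(a)\vee\lambda(b)$; (ii) $\lambda(a\cdot b)=\lambda(a)\wedge\lambda(b)$; (iii) $\lambda(a)\le\lambda(b)$ iff $a^n\le b$ for some integer $n\ge1$. -}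

module Defs where

open import Level using (0ℓ)
open import Data.Nat using (ℕ; zero; suc)
open import Data.Bool using (Bool; true; false; if_then_else_)
open import Data.Empty renaming (⊥ to Empty)
open import Data.List using (List; []; _∷_)
open import Data.Product using (Σ; ∃; _×_; _,_; proj₁)
open import Relation.Binary.PropositionalEquality using (_≡_)
open import Relation.Binary.Structures using (IsPartialOrder)
open import Algebra.Lattice.Structures using (IsDistributiveLattice)
open import Function.Definitions using (Bijective)

-- The complete lattice is given by a partial order and joins ⋁ of
-- arbitrary families indexed by a type I : Set (this covers joins of
-- arbitrary subsets S ⊆ A, indexed by Σ A S).

record Quantale : Set₁ where
  infixl 7 _·_
  infix 4 _≤_
  field
    Carrier        : Set
    _≤_            : Carrier → Carrier → Set
    isPartialOrder : IsPartialOrder _≡_ _≤_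
    ⋁              : {I : Set} → (I → Carrier) → Carrier
    ⋁-upper        : {I : Set} (f : I → Carrier) (i : I) → f i ≤ ⋁ f
    ⋁-least        : {I : Set} (f : I → Carrier) (x : Carrier) →
                     ((i : I) → f i ≤ x) → ⋁ f ≤ x
    _·_            : Carrier → Carrier → Carrier
    1q             : Carrier
    ·-assoc        : ∀ a b c → (a · b) · c ≡ a · (b · c)
    ·-comm         : ∀ a b → a · b ≡ b · a
    ·-identityˡ    : ∀ a → 1q · a ≡ a
    ·-distrib-⋁    : ∀ a {I : Set} (f : I → Carrier) →
                     a · ⋁ f ≡ ⋁ (λ i → a · f i)

  infixl 6 _∨_
  _∨_ : Carrier → Carrier → Carrier
  a ∨ b = ⋁ (λ (t : Bool) → if t then a else b)

  0q : Carrier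
  0q = ⋁ {Empty} (λ ())

  ⋁-list : List Carrier → Carrier
  ⋁-list []       = 0q
  ⋁-list (x ∷ xs) = x ∨ ⋁-list xs

  mapL : {I : Set} → (I → Carrier) → List I → List Carrier
  mapL f []       = []
  mapL f (i ∷ is) = f i ∷ mapL f is

  _^_ : Carrier → ℕ → Carrier
  a ^ zero  = 1q
  a ^ suc n = a · (a ^ n)

  Compact : Carrier → Set₁
  Compact c = {I : Set} (f : I → Carrier) → c ≤ ⋁ f →
              ∃ λ (js : List I) → c ≤ ⋁-list (mapL f js)

  K : Set₁
  K = Σ Carrier Compact

record IsCoherent (A : Quantale) : Set₁ where
  open Quantale A
  field
    joinOfCompacts : ∀ a → Σ Set λ I → Σ (I → Carrier) λ f →
                     ((i : I) → Compact (f i)) × (a ≡ ⋁ f)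
    one-compact    : Compact 1q
    ·-compact      : ∀ a b → Compact a → Compact b → Compact (a · b)

record BDLattice : Set₁ where
  infixr 7 _∧_
  infixr 6 _∨_
  field
    Carrier               : Set
    _∨_                   : Carrier → Carrier → Carrier
    _∧_                   : Carrier → Carrier → Carrier
    ⊤ ⊥                   : Carrier
    isDistributiveLattice : IsDistributiveLattice _≡_ _∨_ _∧_
    ∨-identityʳ           : ∀ x → x ∨ ⊥ ≡ x
    ∧-identityʳ           : ∀ x → x ∧ ⊤ ≡ x

  infix 4 _≤_
  _≤_ : Carrier → Carrier → Set
  x ≤ y = x ∧ y ≡ x

record IsBDLIso (L L' : BDLattice) (f : BDLattice.Carrier L → BDLattice.Carrier L') : Set where
  module L  = BDLattice L
  module L' = BDLattice L'
  field
    pres-∨    : ∀ x y → f (x L.∨ y) ≡ f x L'.∨ f y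
    pres-∧    : ∀ x y → f (x L.∧ y) ≡ f x L'.∧ f y
    pres-⊤    : f L.⊤ ≡ L'.⊤
    pres-⊥    : f L.⊥ ≡ L'.⊥
    bijective : Bijective _≡_ _≡_ f

record Reticulation (A : Quantale) : Set₂ where
  open Quantale A renaming (_∨_ to _∨A_; _≤_ to _≤A_)
  field
    L  : BDLattice
  open BDLattice L renaming (Carrier to |L|; _∨_ to _∨L_; _≤_ to _≤L_)
  field
    λ̂          : K → |L|
    surjective : ∀ y → ∃ λ (k : K) → λ̂ k ≡ y
    ret-∨      : ∀ (a b : K) (h : Compact (proj₁ a ∨A proj₁ b)) →
                 λ̂ (proj₁ a ∨A proj₁ b , h) ≤L (λ̂ a ∨L λ̂ b)
    ret-·      : ∀ (a b : K) (h : Compact (proj₁ a · proj₁ b)) →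
                 λ̂ (proj₁ a · proj₁ b , h) ≡ (λ̂ a ∧ λ̂ b)
    ret-≤      : ∀ (a b : K) →
                 (λ̂ a ≤L λ̂ b → ∃ λ (n : ℕ) → (proj₁ a ^ suc n) ≤A proj₁ b)
                 × ((∃ λ (n : ℕ) → (proj₁ a ^ suc n) ≤A proj₁ b) → λ̂ a ≤L λ̂ b)

-- By axiom (iii), λ(a) ≤ λ(b) holds iff aⁿ ≤ b for some n ≥ 1, a condition that
-- does not mention the reticulation. Hence λ and λ' induce the same preorder on
-- K(A), and since both are surjective, λ(a) ↦ λ'(a) is a well-defined order
-- isomorphism L ≅ L'. An order isomorphism of lattices preserves joins, meets,
-- top and bottom, because these are characterised by the order alone.
module Submission where

open import Level using (0ℓ)
open import Data.Nat using (ℕ; suc)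
open import Data.Product using (Σ; ∃; _×_; _,_; proj₁; proj₂)
open import Relation.Binary.PropositionalEquality using (_≡_; refl; sym; trans)
open import Algebra.Lattice.Bundles using (Lattice)
open import Algebra.Lattice.Structures using (IsDistributiveLattice)
import Algebra.Lattice.Properties.Lattice as LatticeProperties
import Relation.Binary.Lattice as OrderLattice
open import Function.Bundles using (_⇔_; mk⇔; Equivalence)
import Function.Properties.Equivalence as ⇔
open import Function.Definitions using (StrictlySurjective)
open import Function.Consequences.Propositional using (strictlySurjective⇒surjective)
open import Defs

module BDLatticeOrder (L : BDLattice) where
  open BDLattice L
  open IsDistributiveLattice isDistributiveLattice using (isLattice; ∨-comm)

  private
    lattice : Lattice 0ℓ 0ℓ
    lattice = record { isLattice = isLattice }

    -- the library order of a lattice is x ≡ x ∧ y, the symmetric form of _≤_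
    module O = OrderLattice.Lattice (LatticeProperties.∨-∧-orderTheoreticLattice lattice)

  ≤-refl : ∀ {x} → x ≤ x
  ≤-refl = sym O.refl

  ≡⇒≤ : ∀ {x y} → x ≡ y → x ≤ y
  ≡⇒≤ refl = ≤-refl

  ≤-trans : ∀ {x y z} → x ≤ y → y ≤ z → x ≤ z
  ≤-trans p q = sym (O.trans (sym p) (sym q))

  ≤-antisym : ∀ {x y} → x ≤ y → y ≤ x → x ≡ y
  ≤-antisym p q = O.antisym (sym p) (sym q)

  x≤x∨y : ∀ x y → x ≤ x ∨ y
  x≤x∨y x y = sym (O.x≤x∨y x y)

  y≤x∨y : ∀ x y → y ≤ x ∨ y
  y≤x∨y x y = sym (O.y≤x∨y x y)

  ∨-least : ∀ {x y z} → x ≤ z → y ≤ z → x ∨ y ≤ z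
  ∨-least p q = sym (O.∨-least (sym p) (sym q))

  x∧y≤x : ∀ x y → x ∧ y ≤ x
  x∧y≤x x y = sym (O.x∧y≤x x y)

  x∧y≤y : ∀ x y → x ∧ y ≤ y
  x∧y≤y x y = sym (O.x∧y≤y x y)

  ∧-greatest : ∀ {x y z} → x ≤ y → x ≤ z → x ≤ y ∧ z
  ∧-greatest p q = sym (O.∧-greatest (sym p) (sym q))

  x≤⊤ : ∀ x → x ≤ ⊤
  x≤⊤ = ∧-identityʳ

  ⊥≤x : ∀ x → ⊥ ≤ x
  ⊥≤x x = ≤-trans (x≤x∨y ⊥ x) (≡⇒≤ (trans (∨-comm ⊥ x) (∨-identityʳ x)))

module _ {L L' : BDLattice} where
  private
    module L  = BDLattice L
    module L' = BDLattice L'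
    module O  = BDLatticeOrder L
    module O' = BDLatticeOrder L'

  orderIso⇒isBDLIso : (f : L.Carrier → L'.Carrier) →
                      (∀ x y → x L.≤ y ⇔ f x L'.≤ f y) →
                      StrictlySurjective _≡_ f → IsBDLIso L L' f
  orderIso⇒isBDLIso f f-≤⇔ f-surj = record
    { pres-∨    = pres-∨
    ; pres-∧    = pres-∧
    ; pres-⊤    = pres-⊤
    ; pres-⊥    = pres-⊥
    ; bijective = injective , strictlySurjective⇒surjective f-surj
    }
    where
    mono : ∀ {x y} → x L.≤ y → f x L'.≤ f y
    mono = Equivalence.to (f-≤⇔ _ _)

    reflect : ∀ {x y} → f x L'.≤ f y → x L.≤ y
    reflect = Equivalence.from (f-≤⇔ _ _)

    injective : ∀ {x y} → f x ≡ f y → x ≡ y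
    injective e = O.≤-antisym (reflect (O'.≡⇒≤ e)) (reflect (O'.≡⇒≤ (sym e)))

    inverse : L'.Carrier → L.Carrier
    inverse y' = proj₁ (f-surj y')

    f-inverse : ∀ y' → f (inverse y') ≡ y'
    f-inverse y' = proj₂ (f-surj y')

    ≤-inverse : ∀ {x y'} → f x L'.≤ y' → x L.≤ inverse y'
    ≤-inverse p = reflect (O'.≤-trans p (O'.≡⇒≤ (sym (f-inverse _))))

    inverse-≤ : ∀ {x y'} → y' L'.≤ f x → inverse y' L.≤ x
    inverse-≤ p = reflect (O'.≤-trans (O'.≡⇒≤ (f-inverse _)) p)

    pres-∨ : ∀ x y → f (x L.∨ y) ≡ f x L'.∨ f y
    pres-∨ x y = O'.≤-antisym
      (O'.≤-trans (mono (O.∨-least (≤-inverse (O'.x≤x∨y (f x) (f y)))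
                                   (≤-inverse (O'.y≤x∨y (f x) (f y)))))
                  (O'.≡⇒≤ (f-inverse _)))
      (O'.∨-least (mono (O.x≤x∨y x y)) (mono (O.y≤x∨y x y)))

    pres-∧ : ∀ x y → f (x L.∧ y) ≡ f x L'.∧ f y
    pres-∧ x y = O'.≤-antisym
      (O'.∧-greatest (mono (O.x∧y≤x x y)) (mono (O.x∧y≤y x y)))
      (O'.≤-trans (O'.≡⇒≤ (sym (f-inverse _)))
                  (mono (O.∧-greatest (inverse-≤ (O'.x∧y≤x (f x) (f y)))
                                      (inverse-≤ (O'.x∧y≤y (f x) (f y))))))

    pres-⊤ : f L.⊤ ≡ L'.⊤
    pres-⊤ = O'.≤-antisym (O'.x≤⊤ (f L.⊤))
      (O'.≤-trans (O'.≡⇒≤ (sym (f-inverse L'.⊤))) (mono (O.x≤⊤ _)))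

    pres-⊥ : f L.⊥ ≡ L'.⊥
    pres-⊥ = O'.≤-antisym
      (O'.≤-trans (mono (O.⊥≤x _)) (O'.≡⇒≤ (f-inverse L'.⊥))) (O'.⊥≤x (f L.⊥))

  module Factorisation {X : Set₁} (g : X → L.Carrier) (g' : X → L'.Carrier)
    (g-surj : StrictlySurjective _≡_ g) (g'-surj : StrictlySurjective _≡_ g')
    (same-order : ∀ a b → g a L.≤ g b ⇔ g' a L'.≤ g' b) where

    factor : L.Carrier → L'.Carrier
    factor y = g' (proj₁ (g-surj y))

    factor-∘-g : ∀ a → factor (g a) ≡ g' a
    factor-∘-g a = O'.≤-antisym (transfer (O.≡⇒≤ e)) (transfer (O.≡⇒≤ (sym e)))
      where
      transfer : ∀ {b c} → g b L.≤ g c → g' b L'.≤ g' c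
      transfer = Equivalence.to (same-order _ _)
      e : g (proj₁ (g-surj (g a))) ≡ g a
      e = proj₂ (g-surj (g a))

    factor-≤⇔ : ∀ x y → x L.≤ y ⇔ factor x L'.≤ factor y
    factor-≤⇔ x y =
      ⇔.trans (≤-cong (sym (proj₂ (g-surj x))) (sym (proj₂ (g-surj y)))) (same-order _ _)
      where
      ≤-cong : ∀ {u u' v v'} → u ≡ u' → v ≡ v' → u L.≤ v ⇔ u' L.≤ v'
      ≤-cong refl refl = ⇔.refl

    factor-surjective : StrictlySurjective _≡_ factor
    factor-surjective y with g'-surj y
    ... | b , refl = g b , factor-∘-g b

module _ {A : Quantale} (R : Reticulation A) where
  open Quantale A using (_^_) renaming (_≤_ to _≤A_)
  open Reticulation R
  open BDLattice L using (_≤_)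

  λ̂-≤⇔ : ∀ a b → λ̂ a ≤ λ̂ b ⇔ ∃ λ (n : ℕ) → proj₁ a ^ suc n ≤A proj₁ b
  λ̂-≤⇔ a b = mk⇔ (proj₁ (ret-≤ a b)) (proj₂ (ret-≤ a b))

proposition3p3 : (A : Quantale) → IsCoherent A →
    (R R' : Reticulation A) →
    Σ (BDLattice.Carrier (Reticulation.L R) → BDLattice.Carrier (Reticulation.L R')) λ f →
      IsBDLIso (Reticulation.L R) (Reticulation.L R') f ×
      (∀ k → f (Reticulation.λ̂ R k) ≡ Reticulation.λ̂ R' k)
proposition3p3 A _ R R' =
  factor , orderIso⇒isBDLIso factor factor-≤⇔ factor-surjective , factor-∘-g
  where
  module R  = Reticulation R
  module R' = Reticulation R'
  open Factorisation {R.L} {R'.L} R.λ̂ R'.λ̂ R.surjective R'.surjective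
         (λ a b → ⇔.trans (λ̂-≤⇔ R a b) (⇔.sym (λ̂-≤⇔ R' a b)))
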